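{- Let $m\ge 2$ be an integer, let $\alpha$ be a primitive element of $\mathbb{F}_{2^m}$, and let $\mathcal{B}=\{\{x,y,z,x+y+z\} : x,y,z\in\mathbb{F}_{2^m} \text{ distinct}\}$ be the block set of the Boolean $\mathrm{SQS}(2^m)$ on $\mathbb{F}_{2^m}$. Let $j\in\{1,\dots,2^m-2\}$ and let $l$ be the integer in $\{1,\dots,2^m-2\}$ with $\alpha^l=\alpha^j+1$. Put $B=\{0,1,\alpha^j,\alpha^l\}$ and \[\mathcal{B}^{(j)}=\{\alpha^k\cdot(B+t) : k\in\mathbb{Z}_{2^m-1},\ t\in\mathbb{F}_{2^m}\},\] where $\alpha^k\cdot(B+t)=\{\alpha^k(x+t): x\in B\}$ (as a set of distinct blocks). Then: (i) if $m$ is even and $\{j,l\}=\{\frac{2^m-1}{3},\frac{2(2^m-1)}{3}\}$, then $(\mathbb{F}_{2^m},\mathcal{B}^{(j)})$ is a $2$-$(2^m,4,1)$ design with $\mathcal{B}^{(j)}\subseteq\mathcal{B}$; (ii) otherwise, $(\mathbb{F}_{2^m},\mathcal{B}^{(j)})$ is a $2$-$(2^m,4,3)$ design with $\mathcal{B}^{(j)}\subseteq\mathcal{B}$.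
   Context: A $2$-$(v,4,\lambda)$ design is a pair $(V,\mathcal{C})$ with $|V|=v$ and $\mathcal{C}$ a set of $4$-subsets of $V$ such that every $2$-subset of $V$ is contained in exactly $\lambda$ members of $\mathcal{C}$. The Boolean $\mathrm{SQS}(2^m)$ is the Steiner quadruple system on $\mathbb{F}_{2^m}$ (identified with $\mathbb{F}_2^m$) whose blocks are the $4$-sets $\{x,y,z,x+y+z\}$ with $x,y,z$ distinct (equivalently, the $4$-subsets with element sum $0$). -}

module Defs where

open import Data.Nat using (ℕ; zero; suc; _∸_; _^_)
open import Data.Fin using (Fin; toℕ)
open import Data.Fin.Subset using (Subset; _∈_; ∣_∣)
open import Data.List using (List; length)
open import Data.List.Relation.Unary.All using (All)
open import Data.List.Relation.Unary.Unique.Propositional using (Unique)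
import Data.List.Membership.Propositional as L
open import Data.Product using (Σ; ∃; _×_; _,_)
open import Data.Sum using (_⊎_)
open import Relation.Binary.PropositionalEquality using (_≡_; _≢_)
open import Algebra.Core using (Op₁; Op₂)
open import Algebra.Structures using (IsCommutativeRing)

-- A field whose carrier is Fin n (so it has exactly n elements),
-- with propositional equality.  Any field with 2^m elements is F_{2^m}.
record FieldOn (n : ℕ) : Set where
  field
    _+_ _*_ : Op₂ (Fin n)
    -_      : Op₁ (Fin n)
    0# 1#   : Fin n
    isCommutativeRing : IsCommutativeRing _≡_ _+_ _*_ -_ 0# 1#
    0≢1     : 0# ≢ 1#
    inverse : ∀ x → x ≢ 0# → ∃ λ y → x * y ≡ 1#

  infixl 6 _+_
  infixl 7 _*_

  _^^_ : Fin n → ℕ → Fin n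
  x ^^ zero  = 1#
  x ^^ suc k = x * (x ^^ k)
  infixr 8 _^^_

module _ {n : ℕ} (F : FieldOn n) where
  open FieldOn F

  Primitive : Fin n → Set
  Primitive α = ∀ x → x ≢ 0# → ∃ λ k → x ≡ α ^^ k

  BooleanSQSBlock : Subset n → Set
  BooleanSQSBlock S =
    Σ (Fin n) λ x → Σ (Fin n) λ y → Σ (Fin n) λ z →
      x ≢ y × x ≢ z × y ≢ z ×
      (∀ w → (w ∈ S → (w ≡ x ⊎ w ≡ y ⊎ w ≡ z ⊎ w ≡ x + y + z))
           × ((w ≡ x ⊎ w ≡ y ⊎ w ≡ z ⊎ w ≡ x + y + z) → w ∈ S))

  InTranslate : (α β γ : Fin n) (k : ℕ) (t w : Fin n) → Set
  InTranslate α β γ k t w =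
       w ≡ α ^^ k * (0# + t)
     ⊎ w ≡ α ^^ k * (1# + t)
     ⊎ w ≡ α ^^ k * (β + t)
     ⊎ w ≡ α ^^ k * (γ + t)

  BlocksJ : (α : Fin n) (j l : ℕ) → Subset n → Set
  BlocksJ α j l S =
    Σ (Fin (n ∸ 1)) λ k → Σ (Fin n) λ t →
      ∀ w → (w ∈ S → InTranslate α (α ^^ j) (α ^^ l) (toℕ k) t w)
          × (InTranslate α (α ^^ j) (α ^^ l) (toℕ k) t w → w ∈ S)

ExactlyCount : {n : ℕ} → ℕ → (Subset n → Set) → Set
ExactlyCount {n} c P =
  Σ (List (Subset n)) λ L →
    length L ≡ c × Unique L × All P L × (∀ S → P S → S L.∈ L)

Is2Design : {n : ℕ} → (Subset n → Set) → ℕ → Set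
Is2Design {n} 𝓒 λ′ =
  (∀ S → 𝓒 S → ∣ S ∣ ≡ 4) ×
  (∀ (a b : Fin n) → a ≢ b → ExactlyCount λ′ (λ S → 𝓒 S × a ∈ S × b ∈ S))

{-# OPTIONS --safe #-}

-- The field has characteristic 2 (−1 is a power of α whose square is 1, while the order
-- 2^m − 1 of α is odd), so B = {0, 1, β, β + 1} with β = α^j is the additive subgroup
-- spanned by 1 and β.  Hence every block a(B + t) is a 2-dimensional affine subspace over
-- 𝔽₂, i.e. a block of the Boolean SQS, and it is {w : c w + s ∈ B} for c = a⁻¹, s = t.
-- If such a block contains p ≠ q, then e = c(p + q) lies in B ∖ {0} and the block is
-- T e = {w : e (w + p)/(p + q) ∈ B}; so the blocks through p and q are T 1, T β, T (β + 1).
-- When β(β + 1) = 1, i.e. β ∈ 𝔽₄ ∖ 𝔽₂, multiplication by β permutes B and the three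
-- coincide; otherwise β², (β + 1)² and (β + 1)/β lie outside B and they are distinct.
-- Finally β(β + 1) = α^(j+l) is 1 exactly when j + l = 2^m − 1, and then β² = β + 1 gives
-- 2j ≡ l, which forces 3 ∣ 2^m − 1 (so m is even) and {j, l} = {(2^m − 1)/3, 2(2^m − 1)/3}.

module Submission where

open import Defs

open import Algebra.Bundles using (CommutativeRing; RawRing)
import Algebra.Properties.Ring as RingProperties
import Algebra.Solver.Ring as RingSolver
open import Algebra.Solver.Ring.AlmostCommutativeRing
  using (fromCommutativeRing; _-Raw-AlmostCommutative⟶_)
open import Algebra.Structures using (IsCommutativeRing)
open import Data.Bool.Base using (Bool; true; false; _xor_; _∧_)
open import Data.Empty using (⊥-elim)
open import Data.Fin.Base using (Fin; toℕ; fromℕ<; punchIn; punchOut)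
import Data.Fin.Properties as Finₚ
open import Data.Fin.Subset using (Subset; inside; outside; _∈_; _∉_; ∣_∣; ⁅_⁆; _∪_; ⋃)
open import Data.Fin.Subset.Properties
  using (⊆-antisym; ∪-identityˡ; ∣⊥∣≡0; ∉⊥; x∈⁅x⁆; x∈⁅y⁆⇒x≡y; x∈p∪q⁺; x∈p∪q⁻)
open import Data.List.Base using (List; []; _∷_; map; length)
open import Data.List.Membership.Propositional using () renaming (_∈_ to _∈ₗ_)
open import Data.List.Relation.Unary.All using ([]; _∷_)
import Data.List.Relation.Unary.All as All
open import Data.List.Relation.Unary.All.Properties using (All¬⇒¬Any)
open import Data.List.Relation.Unary.AllPairs using ([]; _∷_)
open import Data.List.Relation.Unary.Any using (here; there)
open import Data.List.Relation.Unary.Unique.Propositional using (Unique)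
import Data.List.Relation.Unary.Unique.Propositional.Properties as Uniqueₚ
open import Data.Maybe.Base using (Maybe; just; nothing)
open import Data.Nat.Base as ℕ using (ℕ; zero; suc; _∸_; _^_; _≤_; _<_; s≤s; z≤n; NonZero)
import Data.Nat.Properties as ℕₚ
open import Data.Nat.DivMod using (_%_; _/_; m%n<n; m≡m%n+[m/n]*n; m*n/n≡m)
open import Data.Nat.Divisibility
  using (_∣_; divides; _∣0; ∣-refl; m∣m*n; ∣m∣n⇒∣m+n; ∣m+n∣m⇒∣n; >⇒∤)
open import Data.Product using (Σ; ∃; _×_; _,_; proj₁; proj₂; map₁; map₂)
open import Data.Sum.Base using (_⊎_; inj₁; inj₂)
open import Data.Vec.Base using (_∷_; here; there; tabulate)
open import Data.Vec.Properties using (lookup∘tabulate; lookup⇒[]=; []=⇒lookup)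
open import Function.Base using (_∘_; id)
open import Function.Definitions using (Injective)
open import Level using (0ℓ)
open import Relation.Binary.Definitions using (tri<; tri≈; tri>)
open import Relation.Binary.PropositionalEquality
open import Relation.Nullary using (¬_; Dec; yes; no; does)
open import Relation.Nullary.Decidable using (dec-true; _⊎-dec_)
open import Relation.Unary using (Decidable)

module _ {a} {A : Set a} where

  Among : A → A → A → A → A → Set a
  Among x₀ x₁ x₂ x₃ w = w ≡ x₀ ⊎ w ≡ x₁ ⊎ w ≡ x₂ ⊎ w ≡ x₃

pattern at₀ e = inj₁ e
pattern at₁ e = inj₂ (inj₁ e)
pattern at₂ e = inj₂ (inj₂ (inj₁ e))
pattern at₃ e = inj₂ (inj₂ (inj₂ e))

module _ {a b} {A : Set a} {B : Set b} {x₀ x₁ x₂ x₃ : A} where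

  Among-map : ∀ (f : A → B) {w} → Among x₀ x₁ x₂ x₃ w → Among (f x₀) (f x₁) (f x₂) (f x₃) (f w)
  Among-map f (at₀ refl) = at₀ refl
  Among-map f (at₁ refl) = at₁ refl
  Among-map f (at₂ refl) = at₂ refl
  Among-map f (at₃ refl) = at₃ refl

  Among-preimage : ∀ {f : A → B} {g : B → A} → (∀ x → g (f x) ≡ x) →
                   ∀ {w} → Among (f x₀) (f x₁) (f x₂) (f x₃) w → Among x₀ x₁ x₂ x₃ (g w)
  Among-preimage g∘f≗id (at₀ refl) = at₀ (g∘f≗id x₀)
  Among-preimage g∘f≗id (at₁ refl) = at₁ (g∘f≗id x₁)
  Among-preimage g∘f≗id (at₂ refl) = at₂ (g∘f≗id x₂)
  Among-preimage g∘f≗id (at₃ refl) = at₃ (g∘f≗id x₃)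

module _ {a} {A : Set a} {x₀ x₁ x₂ x₃ : A} where

  Among⇒∈ₗ : ∀ {w} → Among x₀ x₁ x₂ x₃ w → w ∈ₗ x₀ ∷ x₁ ∷ x₂ ∷ x₃ ∷ []
  Among⇒∈ₗ (at₀ e) = here e
  Among⇒∈ₗ (at₁ e) = there (here e)
  Among⇒∈ₗ (at₂ e) = there (there (here e))
  Among⇒∈ₗ (at₃ e) = there (there (there (here e)))

  ∈ₗ⇒Among : ∀ {w} → w ∈ₗ x₀ ∷ x₁ ∷ x₂ ∷ x₃ ∷ [] → Among x₀ x₁ x₂ x₃ w
  ∈ₗ⇒Among (here e)                         = at₀ e
  ∈ₗ⇒Among (there (here e))                 = at₁ e
  ∈ₗ⇒Among (there (there (here e)))         = at₂ e
  ∈ₗ⇒Among (there (there (there (here e)))) = at₃ e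

∣⁅x⁆∪p∣≡1+∣p∣ : ∀ {n} (x : Fin n) (p : Subset n) → x ∉ p → ∣ ⁅ x ⁆ ∪ p ∣ ≡ suc ∣ p ∣
∣⁅x⁆∪p∣≡1+∣p∣ Fin.zero    (inside  ∷ p) x∉p = ⊥-elim (x∉p here)
∣⁅x⁆∪p∣≡1+∣p∣ Fin.zero    (outside ∷ p) _   = cong (suc ∘ ∣_∣) (∪-identityˡ p)
∣⁅x⁆∪p∣≡1+∣p∣ (Fin.suc x) (inside  ∷ p) x∉p = cong suc (∣⁅x⁆∪p∣≡1+∣p∣ x p (x∉p ∘ there))
∣⁅x⁆∪p∣≡1+∣p∣ (Fin.suc x) (outside ∷ p) x∉p = ∣⁅x⁆∪p∣≡1+∣p∣ x p (x∉p ∘ there)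

module _ {n : ℕ} where

  Extension : Subset n → (Fin n → Set) → Set
  Extension S P = ∀ w → (w ∈ S → P w) × (P w → w ∈ S)

  Extension-cong : ∀ {S P Q} → (∀ {w} → P w → Q w) → (∀ {w} → Q w → P w) →
                   Extension S P → Extension S Q
  Extension-cong P⇒Q Q⇒P S≐P w = P⇒Q ∘ proj₁ (S≐P w) , proj₂ (S≐P w) ∘ Q⇒P

  Extension-unique : ∀ {S S′ P} → Extension S P → Extension S′ P → S ≡ S′
  Extension-unique S≐P S′≐P = ⊆-antisym (λ {w} → proj₂ (S′≐P w) ∘ proj₁ (S≐P w))
                                         (λ {w} → proj₂ (S≐P w) ∘ proj₁ (S′≐P w))

  subsetOf : ∀ {P : Fin n → Set} → Decidable P → Subset n
  subsetOf P? = tabulate (does ∘ P?)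

  subsetOf-extension : ∀ {P : Fin n → Set} (P? : Decidable P) → Extension (subsetOf P?) P
  subsetOf-extension {P} P? w =
      (λ w∈S → does⇒ (P? w) (trans (sym (lookup∘tabulate _ w)) ([]=⇒lookup w∈S)))
    , (λ Pw → lookup⇒[]= w _ (trans (lookup∘tabulate _ w) (dec-true (P? w) Pw)))
    where
    does⇒ : (w? : Dec (P w)) → does w? ≡ true → P w
    does⇒ (yes Pw) _ = Pw

  fromList : List (Fin n) → Subset n
  fromList xs = ⋃ (map ⁅_⁆ xs)

  fromList-extension : ∀ xs → Extension (fromList xs) (_∈ₗ xs)
  fromList-extension []       w = ⊥-elim ∘ ∉⊥ , λ ()
  fromList-extension (x ∷ xs) w = from , to
    where
    from : w ∈ ⁅ x ⁆ ∪ fromList xs → w ∈ₗ x ∷ xs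
    from w∈ with x∈p∪q⁻ ⁅ x ⁆ (fromList xs) w∈
    ... | inj₁ w∈x  = here (x∈⁅y⁆⇒x≡y x w∈x)
    ... | inj₂ w∈xs = there (proj₁ (fromList-extension xs w) w∈xs)
    to : w ∈ₗ x ∷ xs → w ∈ ⁅ x ⁆ ∪ fromList xs
    to (here refl)  = x∈p∪q⁺ (inj₁ (x∈⁅x⁆ w))
    to (there w∈xs) = x∈p∪q⁺ (inj₂ (proj₂ (fromList-extension xs w) w∈xs))

  ∣fromList∣≡length : ∀ {xs} → Unique xs → ∣ fromList xs ∣ ≡ length xs
  ∣fromList∣≡length {[]}     []           = ∣⊥∣≡0 n
  ∣fromList∣≡length {x ∷ xs} (x∉xs ∷ xs!) = trans
    (∣⁅x⁆∪p∣≡1+∣p∣ x (fromList xs) (All¬⇒¬Any x∉xs ∘ proj₁ (fromList-extension xs x)))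
    (cong suc (∣fromList∣≡length xs!))

  ∣S∣≡length : ∀ {S xs} → Unique xs → Extension S (_∈ₗ xs) → ∣ S ∣ ≡ length xs
  ∣S∣≡length {xs = xs} xs! S≐xs =
    trans (cong ∣_∣ (Extension-unique S≐xs (fromList-extension xs))) (∣fromList∣≡length xs!)

Is2Design-cong : ∀ {n} {P Q : Subset n → Set} {λ′} → (∀ {S} → P S → Q S) → (∀ {S} → Q S → P S) →
                 Is2Design P λ′ → Is2Design Q λ′
Is2Design-cong {P = P} {Q} P⇒Q Q⇒P (P-size , P-count) =
  (λ S → P-size S ∘ Q⇒P) , λ a b a≢b → ExactlyCount-cong (P-count a b a≢b)
  where
  ExactlyCount-cong : ∀ {a b λ′} → ExactlyCount λ′ (λ S → P S × a ∈ S × b ∈ S) →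
                                   ExactlyCount λ′ (λ S → Q S × a ∈ S × b ∈ S)
  ExactlyCount-cong (L , |L|≡λ , L! , all , complete) =
    L , |L|≡λ , L! , All.map (map₁ P⇒Q) all , λ S → complete S ∘ map₁ Q⇒P

-- punchIn for sizes that are not syntactically successors, such as 2 ^ m.
punchIn′ : ∀ {n} → Fin n → Fin (n ∸ 1) → Fin n
punchIn′ {suc n} i = punchIn i

punchIn′ᵢ≢i : ∀ {n} (i : Fin n) j → punchIn′ i j ≢ i
punchIn′ᵢ≢i {suc n} = Finₚ.punchInᵢ≢i

punchIn′-injective : ∀ {n} (i : Fin n) → Injective _≡_ _≡_ (punchIn′ i)
punchIn′-injective {suc n} i = Finₚ.punchIn-injective i _ _

punchIn′-surjective : ∀ {n} {i x : Fin n} → x ≢ i → ∃ λ j → punchIn′ i j ≡ x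
punchIn′-surjective {suc n} x≢i = punchOut (x≢i ∘ sym) , Finₚ.punchIn-punchOut (x≢i ∘ sym)

module FieldProperties {n : ℕ} (F : FieldOn n) where

  open FieldOn F public
  open IsCommutativeRing isCommutativeRing public
    using (+-assoc; +-comm; +-identityˡ; +-identityʳ; -‿inverseʳ;
           *-assoc; *-comm; *-identityˡ; *-identityʳ; zeroˡ; zeroʳ)

  commutativeRing : CommutativeRing 0ℓ 0ℓ
  commutativeRing = record { isCommutativeRing = isCommutativeRing }

  open RingProperties (CommutativeRing.ring commutativeRing) public
    using (+-cancelˡ; +-cancelʳ; +-inverseʳ-unique)
  open RingProperties (CommutativeRing.ring commutativeRing)
    using (-1*x≈-x; -‿involutive)

  -1*-1≡1 : - 1# * - 1# ≡ 1#
  -1*-1≡1 = trans (-1*x≈-x (- 1#)) (-‿involutive 1#)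

  1≢0 : 1# ≢ 0#
  1≢0 = 0≢1 ∘ sym

  inv : ∀ x → x ≢ 0# → Fin n
  inv x x≢0 = proj₁ (inverse x x≢0)

  inv-inverseʳ : ∀ {x} (x≢0 : x ≢ 0#) → x * inv x x≢0 ≡ 1#
  inv-inverseʳ {x} x≢0 = proj₂ (inverse x x≢0)

  inv-inverseˡ : ∀ {x} (x≢0 : x ≢ 0#) → inv x x≢0 * x ≡ 1#
  inv-inverseˡ {x} x≢0 = trans (*-comm _ x) (inv-inverseʳ x≢0)

  x*y≡1⇒y≢0 : ∀ {x y} → x * y ≡ 1# → y ≢ 0#
  x*y≡1⇒y≢0 {x} xy≡1 refl = 1≢0 (trans (sym xy≡1) (zeroʳ x))

  x*y≡1⇒x*[y*z]≡z : ∀ {x y} → x * y ≡ 1# → ∀ z → x * (y * z) ≡ z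
  x*y≡1⇒x*[y*z]≡z {x} {y} xy≡1 z =
    trans (sym (*-assoc x y z)) (trans (cong (_* z) xy≡1) (*-identityˡ z))

  *-cancelˡ : ∀ {x y z} → x ≢ 0# → x * y ≡ x * z → y ≡ z
  *-cancelˡ {x} {y} {z} x≢0 xy≡xz = begin
    y                        ≡⟨ sym (x*y≡1⇒x*[y*z]≡z (inv-inverseˡ x≢0) y) ⟩
    inv x x≢0 * (x * y)      ≡⟨ cong (inv x x≢0 *_) xy≡xz ⟩
    inv x x≢0 * (x * z)      ≡⟨ x*y≡1⇒x*[y*z]≡z (inv-inverseˡ x≢0) z ⟩
    z                        ∎
    where open ≡-Reasoning

  x*y≢0 : ∀ {x y} → x ≢ 0# → y ≢ 0# → x * y ≢ 0#
  x*y≢0 {x} x≢0 y≢0 xy≡0 = y≢0 (*-cancelˡ x≢0 (trans xy≡0 (sym (zeroʳ x))))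

  ^^-distribˡ-+-* : ∀ x k l → x ^^ (k ℕ.+ l) ≡ x ^^ k * x ^^ l
  ^^-distribˡ-+-* x zero    l = sym (*-identityˡ _)
  ^^-distribˡ-+-* x (suc k) l =
    trans (cong (x *_) (^^-distribˡ-+-* x k l)) (sym (*-assoc x _ _))

  ^^-≢0 : ∀ {x} → x ≢ 0# → ∀ k → x ^^ k ≢ 0#
  ^^-≢0 x≢0 zero    = 1≢0
  ^^-≢0 x≢0 (suc k) = x*y≢0 x≢0 (^^-≢0 x≢0 k)

  0^^k≡0 : ∀ {k} → 0 < k → 0# ^^ k ≡ 0#
  0^^k≡0 {suc k} _ = zeroˡ (0# ^^ k)

  x^r≡1⇒x^k≡x^[k%r] : ∀ {x} r .{{_ : NonZero r}} → x ^^ r ≡ 1# → ∀ k → x ^^ k ≡ x ^^ (k % r)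
  x^r≡1⇒x^k≡x^[k%r] {x} r x^r≡1 k = begin
    x ^^ k                           ≡⟨ cong (x ^^_) (m≡m%n+[m/n]*n k r) ⟩
    x ^^ (k % r ℕ.+ k / r ℕ.* r)     ≡⟨ ^^-distribˡ-+-* x (k % r) (k / r ℕ.* r) ⟩
    x ^^ (k % r) * x ^^ (k / r ℕ.* r) ≡⟨ cong (x ^^ (k % r) *_) (x^[q*r]≡1 (k / r)) ⟩
    x ^^ (k % r) * 1#                ≡⟨ *-identityʳ _ ⟩
    x ^^ (k % r)                     ∎
    where
    open ≡-Reasoning
    x^[q*r]≡1 : ∀ q → x ^^ (q ℕ.* r) ≡ 1#
    x^[q*r]≡1 zero    = refl
    x^[q*r]≡1 (suc q) = begin
      x ^^ (r ℕ.+ q ℕ.* r)      ≡⟨ ^^-distribˡ-+-* x r (q ℕ.* r) ⟩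
      x ^^ r * x ^^ (q ℕ.* r)   ≡⟨ cong₂ _*_ x^r≡1 (x^[q*r]≡1 q) ⟩
      1# * 1#                   ≡⟨ *-identityˡ 1# ⟩
      1#                        ∎

  x^k≡x^l⇒x^[l∸k]≡1 : ∀ {x} → x ≢ 0# → ∀ {k l} → k ≤ l → x ^^ k ≡ x ^^ l → x ^^ (l ∸ k) ≡ 1#
  x^k≡x^l⇒x^[l∸k]≡1 {x} x≢0 {k} {l} k≤l x^k≡x^l = sym (*-cancelˡ (^^-≢0 x≢0 k) (begin
    x ^^ k * 1#              ≡⟨ *-identityʳ _ ⟩
    x ^^ k                   ≡⟨ x^k≡x^l ⟩
    x ^^ l                   ≡⟨ cong (x ^^_) (sym (ℕₚ.m+[n∸m]≡n k≤l)) ⟩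
    x ^^ (k ℕ.+ (l ∸ k))     ≡⟨ ^^-distribˡ-+-* x k (l ∸ k) ⟩
    x ^^ k * x ^^ (l ∸ k)    ∎))
    where open ≡-Reasoning

-- A ring solver with coefficients in 𝔽₂ = (Bool, xor, ∧), so that it also proves
-- identities that only hold in characteristic 2, such as x + x ≡ 0.
module Characteristic2 {n : ℕ} (F : FieldOn n)
                       (1+1≡0 : FieldOn._+_ F (FieldOn.1# F) (FieldOn.1# F) ≡ FieldOn.0# F) where

  open FieldProperties F

  private
    𝔽₂ : RawRing 0ℓ 0ℓ
    𝔽₂ = record { Carrier = Bool ; _≈_ = _≡_ ; _+_ = _xor_ ; _*_ = _∧_ ; -_ = id ; 0# = false ; 1# = true }

    ⟦_⟧ : Bool → Fin n
    ⟦ false ⟧ = 0#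
    ⟦ true  ⟧ = 1#

    ⟦⟧-homomorphism : 𝔽₂ -Raw-AlmostCommutative⟶ fromCommutativeRing commutativeRing
    ⟦⟧-homomorphism = record
      { ⟦_⟧    = ⟦_⟧
      ; +-homo = λ where false _     → sym (+-identityˡ _)
                         true  false → sym (+-identityʳ 1#)
                         true  true  → sym 1+1≡0
      ; *-homo = λ where false y → sym (zeroˡ ⟦ y ⟧)
                         true  y → sym (*-identityˡ ⟦ y ⟧)
      ; -‿homo = λ where false → +-inverseʳ-unique 0# 0# (+-identityˡ 0#)
                         true  → +-inverseʳ-unique 1# 1# 1+1≡0
      ; 0-homo = refl
      ; 1-homo = refl
      }

    ⟦⟧-injective? : ∀ x y → Maybe (⟦ x ⟧ ≡ ⟦ y ⟧)
    ⟦⟧-injective? false false = just refl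
    ⟦⟧-injective? true  true  = just refl
    ⟦⟧-injective? _     _     = nothing

  open RingSolver 𝔽₂ (fromCommutativeRing commutativeRing) ⟦⟧-homomorphism ⟦⟧-injective? public
    using (solve; _:=_; _:+_; _:*_; con)

  x+x≡0 : ∀ x → x + x ≡ 0#
  x+x≡0 = solve 1 (λ x → x :+ x := con false) refl

  x+y+y≡x : ∀ x y → x + y + y ≡ x
  x+y+y≡x = solve 2 (λ x y → x :+ y :+ y := x) refl

  x+y≡0⇒x≡y : ∀ {x y} → x + y ≡ 0# → x ≡ y
  x+y≡0⇒x≡y {x} {y} x+y≡0 = trans (sym (x+y+y≡x x y)) (trans (cong (_+ y) x+y≡0) (+-identityˡ y))

  x*[x+1]≡1⇒x*x≡x+1 : ∀ {x} → x * (x + 1#) ≡ 1# → x * x ≡ x + 1#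
  x*[x+1]≡1⇒x*x≡x+1 {x} x[x+1]≡1 = begin
    x * x                 ≡⟨ solve 1 (λ x → x :* x := x :* (x :+ con true) :+ x) refl x ⟩
    x * (x + 1#) + x      ≡⟨ cong (_+ x) x[x+1]≡1 ⟩
    1# + x                ≡⟨ +-comm 1# x ⟩
    x + 1#                ∎
    where open ≡-Reasoning

module PrimitiveElement {n : ℕ} (F : FieldOn n) {α : Fin n} (α-primitive : Primitive F α)
                        (α≢0 : α ≢ FieldOn.0# F) where

  open FieldProperties F

  N : ℕ
  N = n ∸ 1

  instance
    N-nonZero : NonZero N
    N-nonZero = Finₚ.nonZeroIndex (proj₁ (punchIn′-surjective {i = 0#} 1≢0))

  -- Reducing exponents modulo r embeds the N nonzero elements into Fin r.
  α^r≡1⇒N≤r : ∀ {r} → 0 < r → α ^^ r ≡ 1# → N ≤ r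
  α^r≡1⇒N≤r {r@(suc _)} _ α^r≡1 = Finₚ.injective⇒≤ ι-injective
    where
    open ≡-Reasoning
    exponent : Fin N → ℕ
    exponent y = proj₁ (α-primitive (punchIn′ 0# y) (punchIn′ᵢ≢i 0# y))
    ι : Fin N → Fin r
    ι y = fromℕ< (m%n<n (exponent y) r)
    α^exponent≡α^ι : ∀ y → α ^^ exponent y ≡ α ^^ toℕ (ι y)
    α^exponent≡α^ι y = trans (x^r≡1⇒x^k≡x^[k%r] r α^r≡1 (exponent y)) (cong (α ^^_) (sym (Finₚ.toℕ-fromℕ< (m%n<n (exponent y) r))))
    ι-injective : Injective _≡_ _≡_ ι
    ι-injective {y} {y′} ιy≡ιy′ = punchIn′-injective 0# (begin
      punchIn′ 0# y         ≡⟨ proj₂ (α-primitive _ _) ⟩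
      α ^^ exponent y       ≡⟨ α^exponent≡α^ι y ⟩
      α ^^ toℕ (ι y)        ≡⟨ cong (λ i → α ^^ toℕ i) ιy≡ιy′ ⟩
      α ^^ toℕ (ι y′)       ≡⟨ sym (α^exponent≡α^ι y′) ⟩
      α ^^ exponent y′      ≡⟨ sym (proj₂ (α-primitive _ _)) ⟩
      punchIn′ 0# y′        ∎)

  private
    position : Fin (suc N) → Fin N
    position i = proj₁ (punchIn′-surjective (^^-≢0 α≢0 (toℕ i)))

    position-correct : ∀ i → punchIn′ 0# (position i) ≡ α ^^ toℕ i
    position-correct i = proj₂ (punchIn′-surjective (^^-≢0 α≢0 (toℕ i)))

  -- Two of the N + 1 nonzero powers α ^^ 0, …, α ^^ N coincide.
  α^N≡1 : α ^^ N ≡ 1#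
  α^N≡1 with Finₚ.pigeonhole (ℕₚ.n<1+n N) position
  ... | i , j , i<j , position-i≡position-j = subst (λ d → α ^^ d ≡ 1#) j∸i≡N α^[j∸i]≡1
    where
    α^[j∸i]≡1 : α ^^ (toℕ j ∸ toℕ i) ≡ 1#
    α^[j∸i]≡1 = x^k≡x^l⇒x^[l∸k]≡1 α≢0 (ℕₚ.<⇒≤ i<j) (trans (sym (position-correct i))
                  (trans (cong (punchIn′ 0#) position-i≡position-j) (position-correct j)))
    j∸i≡N : toℕ j ∸ toℕ i ≡ N
    j∸i≡N = ℕₚ.≤-antisym (ℕₚ.≤-trans (ℕₚ.m∸n≤m (toℕ j) (toℕ i)) (ℕₚ.≤-pred (Finₚ.toℕ<n j)))
                         (α^r≡1⇒N≤r (ℕₚ.m<n⇒0<n∸m i<j) α^[j∸i]≡1)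

  α^a≢α^b : ∀ {a b} → a < b → b < N → α ^^ a ≢ α ^^ b
  α^a≢α^b {a} {b} a<b b<N α^a≡α^b = ℕₚ.<⇒≱ (ℕₚ.≤-<-trans (ℕₚ.m∸n≤m b a) b<N)
    (α^r≡1⇒N≤r (ℕₚ.m<n⇒0<n∸m a<b) (x^k≡x^l⇒x^[l∸k]≡1 α≢0 (ℕₚ.<⇒≤ a<b) α^a≡α^b))

  α^a≡α^b⇒a≡b : ∀ {a b} → a < N → b < N → α ^^ a ≡ α ^^ b → a ≡ b
  α^a≡α^b⇒a≡b {a} {b} a<N b<N α^a≡α^b with ℕₚ.<-cmp a b
  ... | tri< a<b _ _ = ⊥-elim (α^a≢α^b a<b b<N α^a≡α^b)
  ... | tri≈ _ a≡b _ = a≡b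
  ... | tri> _ _ b<a = ⊥-elim (α^a≢α^b b<a a<N (sym α^a≡α^b))

  α^[N+k]≡α^k : ∀ k → α ^^ (N ℕ.+ k) ≡ α ^^ k
  α^[N+k]≡α^k k = trans (^^-distribˡ-+-* α N k) (trans (cong (_* α ^^ k) α^N≡1) (*-identityˡ _))

  α^a≡α^b⇒a≡b⊎a≡N+b : ∀ {a b} → a < N ℕ.+ N → b < N → α ^^ a ≡ α ^^ b → a ≡ b ⊎ a ≡ N ℕ.+ b
  α^a≡α^b⇒a≡b⊎a≡N+b {a} {b} a<2N b<N α^a≡α^b with a ℕₚ.<? N
  ... | yes a<N = inj₁ (α^a≡α^b⇒a≡b a<N b<N α^a≡α^b)
  ... | no  a≮N = inj₂ (begin
    a                 ≡⟨ sym (ℕₚ.m+[n∸m]≡n N≤a) ⟩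
    N ℕ.+ (a ∸ N)     ≡⟨ cong (N ℕ.+_) (α^a≡α^b⇒a≡b (ℕₚ.m<n+o⇒m∸n<o a N a<2N) b<N α^[a∸N]≡α^b) ⟩
    N ℕ.+ b           ∎)
    where
    open ≡-Reasoning
    N≤a = ℕₚ.≮⇒≥ a≮N
    α^[a∸N]≡α^b : α ^^ (a ∸ N) ≡ α ^^ b
    α^[a∸N]≡α^b = trans (sym (α^[N+k]≡α^k (a ∸ N)))
                        (trans (cong (α ^^_) (ℕₚ.m+[n∸m]≡n N≤a)) α^a≡α^b)

  log : ∀ x → x ≢ 0# → Σ (Fin N) λ k → α ^^ toℕ k ≡ x
  log x x≢0 = fromℕ< (m%n<n e N) , (begin
    α ^^ toℕ (fromℕ< (m%n<n e N))  ≡⟨ cong (α ^^_) (Finₚ.toℕ-fromℕ< (m%n<n e N)) ⟩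
    α ^^ (e % N)                   ≡⟨ sym (x^r≡1⇒x^k≡x^[k%r] N α^N≡1 e) ⟩
    α ^^ e                         ≡⟨ sym (proj₂ (α-primitive x x≢0)) ⟩
    x                              ∎)
    where
    open ≡-Reasoning
    e = proj₁ (α-primitive x x≢0)

  -- − 1# = α ^^ k with α ^^ (k + k) ≡ 1#, and as N is odd this forces k = 0.
  characteristic-2 : ¬ 2 ∣ N → 1# + 1# ≡ 0#
  characteristic-2 N-odd = begin
    1# + 1#      ≡⟨ cong (1# +_) (sym -1≡1) ⟩
    1# + - 1#    ≡⟨ -‿inverseʳ 1# ⟩
    0#           ∎
    where
    open ≡-Reasoning
    -1≢0 : - 1# ≢ 0#
    -1≢0 = x*y≡1⇒y≢0 -1*-1≡1
    k = toℕ (proj₁ (log (- 1#) -1≢0))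
    α^k≡-1 : α ^^ k ≡ - 1#
    α^k≡-1 = proj₂ (log (- 1#) -1≢0)
    α^[k+k]≡1 : α ^^ (k ℕ.+ k) ≡ 1#
    α^[k+k]≡1 = trans (^^-distribˡ-+-* α k k) (trans (cong₂ _*_ α^k≡-1 α^k≡-1) -1*-1≡1)
    k<N : k < N
    k<N = Finₚ.toℕ<n (proj₁ (log (- 1#) -1≢0))
    -1≡1 : - 1# ≡ 1#
    -1≡1 with α^a≡α^b⇒a≡b⊎a≡N+b (ℕₚ.+-mono-< k<N k<N) (ℕ.>-nonZero⁻¹ N) α^[k+k]≡1
    ... | inj₁ k+k≡0   = trans (sym α^k≡-1) (cong (α ^^_) (ℕₚ.m+n≡0⇒m≡0 k k+k≡0))
    ... | inj₂ k+k≡N+0 = ⊥-elim (N-odd (subst (2 ∣_) (trans k+k≡N+0 (ℕₚ.+-identityʳ N)) 2∣k+k))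
      where
      2∣k+k : 2 ∣ k ℕ.+ k
      2∣k+k = subst (2 ∣_) (cong (k ℕ.+_) (ℕₚ.+-identityʳ k)) (m∣m*n k)

Translates : ∀ {n} → FieldOn n → (α β γ : Fin n) → Subset n → Set
Translates {n} F α β γ S =
  Σ (Fin (n ∸ 1)) λ k → Σ (Fin n) λ t → Extension S (InTranslate F α β γ (toℕ k) t)

module AffineBlocks {n : ℕ} (F : FieldOn n)
                    (1+1≡0 : FieldOn._+_ F (FieldOn.1# F) (FieldOn.1# F) ≡ FieldOn.0# F)
                    {β : Fin n} (β≢0 : β ≢ FieldOn.0# F) (β≢1 : β ≢ FieldOn.1# F) where

  open FieldProperties F
  open Characteristic2 F 1+1≡0

  γ : Fin n
  γ = β + 1#

  InB : Fin n → Set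
  InB = Among 0# 1# β γ

  InB? : Decidable InB
  InB? u = u Finₚ.≟ 0# ⊎-dec u Finₚ.≟ 1# ⊎-dec u Finₚ.≟ β ⊎-dec u Finₚ.≟ γ

  γ≢0 : γ ≢ 0#
  γ≢0 = β≢1 ∘ x+y≡0⇒x≡y

  B-unique : Unique (0# ∷ 1# ∷ β ∷ γ ∷ [])
  B-unique = (0≢1 ∷ β≢0 ∘ sym ∷ γ≢0 ∘ sym ∷ [])
           ∷ (β≢1 ∘ sym ∷ 1≢γ ∷ [])
           ∷ (β≢γ ∷ [])
           ∷ []
           ∷ []
    where
    1≢γ : 1# ≢ γ
    1≢γ 1≡β+1 = β≢0 (sym (+-cancelʳ 1# 0# β (trans (+-identityˡ 1#) 1≡β+1)))
    β≢γ : β ≢ γ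
    β≢γ β≡β+1 = 0≢1 (+-cancelˡ β 0# 1# (trans (+-identityʳ β) β≡β+1))

  InB-+1 : ∀ {u} → InB u → InB (u + 1#)
  InB-+1 (at₀ refl) = at₁ (+-identityˡ 1#)
  InB-+1 (at₁ refl) = at₀ 1+1≡0
  InB-+1 (at₂ refl) = at₃ refl
  InB-+1 (at₃ refl) = at₂ (x+y+y≡x β 1#)

  InB-+β : ∀ {u} → InB u → InB (u + β)
  InB-+β (at₀ refl) = at₂ (+-identityˡ β)
  InB-+β (at₁ refl) = at₃ (+-comm 1# β)
  InB-+β (at₂ refl) = at₀ (x+x≡0 β)
  InB-+β (at₃ refl) = at₁ (solve 1 (λ b → b :+ con true :+ b := con true) refl β)

  InB-+ : ∀ {u v} → InB u → InB v → InB (u + v)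
  InB-+ {u} u∈B (at₀ refl) = subst InB (sym (+-identityʳ u)) u∈B
  InB-+     u∈B (at₁ refl) = InB-+1 u∈B
  InB-+     u∈B (at₂ refl) = InB-+β u∈B
  InB-+ {u} u∈B (at₃ refl) = subst InB (+-assoc u β 1#) (InB-+1 (InB-+β u∈B))

  Image : Fin n → Fin n → Fin n → Set
  Image a t = Among (a * (0# + t)) (a * (1# + t)) (a * (β + t)) (a * (γ + t))

  IsBlock : Subset n → Set
  IsBlock S = ∃ λ a → a ≢ 0# × ∃ λ t → Extension S (Image a t)

  Image⇒InB : ∀ {a c t w} → c * a ≡ 1# → Image a t w → InB (c * w + t)
  Image⇒InB {a} {c} {t} ca≡1 = Among-preimage c[a[u+t]]+t≡u
    where
    c[a[u+t]]+t≡u : ∀ u → c * (a * (u + t)) + t ≡ u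
    c[a[u+t]]+t≡u u = trans (cong (_+ t) (x*y≡1⇒x*[y*z]≡z ca≡1 (u + t))) (x+y+y≡x u t)

  InB⇒Image : ∀ {a c t w} → a * c ≡ 1# → InB (c * w + t) → Image a t w
  InB⇒Image {a} {c} {t} {w} ac≡1 cw+t∈B =
    subst (Image a t) a[cw+t+t]≡w (Among-map (λ u → a * (u + t)) cw+t∈B)
    where
    a[cw+t+t]≡w : a * (c * w + t + t) ≡ w
    a[cw+t+t]≡w = trans (cong (a *_) (x+y+y≡x (c * w) t)) (x*y≡1⇒x*[y*z]≡z ac≡1 w)

  IsBlock⇒preimage : ∀ {S} → IsBlock S → ∃ λ c → c ≢ 0# × ∃ λ s → Extension S (λ w → InB (c * w + s))
  IsBlock⇒preimage (a , a≢0 , t , S≐aB+t) =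
      inv a a≢0 , x*y≡1⇒y≢0 (inv-inverseʳ a≢0) , t
    , Extension-cong (Image⇒InB (inv-inverseˡ a≢0)) (InB⇒Image (inv-inverseʳ a≢0)) S≐aB+t

  preimage⇒IsBlock : ∀ {S c s} → c ≢ 0# → Extension S (λ w → InB (c * w + s)) → IsBlock S
  preimage⇒IsBlock {s = s} c≢0 S≐c⁻¹[B+s] =
      inv _ c≢0 , x*y≡1⇒y≢0 (inv-inverseʳ c≢0) , s
    , Extension-cong (InB⇒Image (inv-inverseˡ c≢0)) (Image⇒InB (inv-inverseʳ c≢0)) S≐c⁻¹[B+s]

  a[u+t]-injective : ∀ {a} → a ≢ 0# → ∀ t {u v} → a * (u + t) ≡ a * (v + t) → u ≡ v
  a[u+t]-injective a≢0 t {u} {v} = +-cancelʳ t u v ∘ *-cancelˡ a≢0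

  IsBlock⇒∣S∣≡4 : ∀ {S} → IsBlock S → ∣ S ∣ ≡ 4
  IsBlock⇒∣S∣≡4 (a , a≢0 , t , S≐aB+t) =
    ∣S∣≡length (Uniqueₚ.map⁺ (a[u+t]-injective a≢0 t) B-unique)
               (Extension-cong Among⇒∈ₗ ∈ₗ⇒Among S≐aB+t)

  IsBlock⇒BooleanSQSBlock : ∀ {S} → IsBlock S → BooleanSQSBlock F S
  IsBlock⇒BooleanSQSBlock {S} (a , a≢0 , t , S≐aB+t) =
      f 0# , f 1# , f β , f-distinct 0≢1 , f-distinct (β≢0 ∘ sym) , f-distinct (β≢1 ∘ sym)
    , subst (λ x → Extension S (Among (f 0#) (f 1#) (f β) x)) (sym f0+f1+fβ≡fγ) S≐aB+t
    where
    f : Fin n → Fin n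
    f u = a * (u + t)
    f-distinct : ∀ {u v} → u ≢ v → f u ≢ f v
    f-distinct u≢v = u≢v ∘ a[u+t]-injective a≢0 t
    f0+f1+fβ≡fγ : f 0# + f 1# + f β ≡ f γ
    f0+f1+fβ≡fγ = solve 3 (λ a t b → a :* (con false :+ t) :+ a :* (con true :+ t) :+ a :* (b :+ t)
                                    := a :* (b :+ con true :+ t)) refl a t β

  -- β * γ ≡ 1# says β² + β + 1 = 0, i.e. β ∈ 𝔽₄ ∖ 𝔽₂: case (i) of the theorem.
  module F4 (βγ≡1 : β * γ ≡ 1#) where

    β*-stable : ∀ {z} → InB z → InB (β * z)
    β*-stable (at₀ refl) = at₀ (zeroʳ β)
    β*-stable (at₁ refl) = at₂ (*-identityʳ β)
    β*-stable (at₂ refl) = at₃ (x*[x+1]≡1⇒x*x≡x+1 βγ≡1)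
    β*-stable (at₃ refl) = at₁ βγ≡1

    γ*-stable : ∀ {z} → InB z → InB (γ * z)
    γ*-stable {z} = subst InB β[βz]≡γz ∘ β*-stable ∘ β*-stable
      where
      β[βz]≡γz : β * (β * z) ≡ γ * z
      β[βz]≡γz = trans (sym (*-assoc β β z)) (cong (_* z) (x*[x+1]≡1⇒x*x≡x+1 βγ≡1))

    β*-stable⁻¹ : ∀ {z} → InB (β * z) → InB z
    β*-stable⁻¹ = subst InB (x*y≡1⇒x*[y*z]≡z (trans (*-comm γ β) βγ≡1) _) ∘ γ*-stable

    γ*-stable⁻¹ : ∀ {z} → InB (γ * z) → InB z
    γ*-stable⁻¹ = subst InB (x*y≡1⇒x*[y*z]≡z βγ≡1 _) ∘ β*-stable

  module NotF4 (βγ≢1 : β * γ ≢ 1#) where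

    β*β∉B : ¬ InB (β * β)
    β*β∉B (at₀ ββ≡0) = x*y≢0 β≢0 β≢0 ββ≡0
    β*β∉B (at₁ ββ≡1) = x*y≢0 γ≢0 γ≢0 (begin
      γ * γ        ≡⟨ solve 1 (λ b → (b :+ con true) :* (b :+ con true) := b :* b :+ con true) refl β ⟩
      β * β + 1#   ≡⟨ cong (_+ 1#) ββ≡1 ⟩
      1# + 1#      ≡⟨ 1+1≡0 ⟩
      0#           ∎)
      where open ≡-Reasoning
    β*β∉B (at₂ ββ≡β) = β≢1 (*-cancelˡ β≢0 (trans ββ≡β (sym (*-identityʳ β))))
    β*β∉B (at₃ ββ≡γ) = βγ≢1 (begin
      β * γ        ≡⟨ solve 1 (λ b → b :* (b :+ con true) := b :* b :+ b) refl β ⟩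
      β * β + β    ≡⟨ cong (_+ β) ββ≡γ ⟩
      γ + β        ≡⟨ solve 1 (λ b → b :+ con true :+ b := con true) refl β ⟩
      1#           ∎)
      where open ≡-Reasoning

    γ*γ∉B : ¬ InB (γ * γ)
    γ*γ∉B = β*β∉B ∘ subst InB γγ+1≡ββ ∘ InB-+1
      where
      γγ+1≡ββ : γ * γ + 1# ≡ β * β
      γγ+1≡ββ = solve 1 (λ b → (b :+ con true) :* (b :+ con true) :+ con true := b :* b) refl β

    β⁻¹ : Fin n
    β⁻¹ = inv β β≢0

    β⁻¹∉B : ¬ InB β⁻¹
    β⁻¹∉B (at₀ β⁻¹≡0) = x*y≡1⇒y≢0 (inv-inverseʳ β≢0) β⁻¹≡0
    β⁻¹∉B (at₁ β⁻¹≡1) = β≢1 (trans (sym (*-identityʳ β)) (trans (cong (β *_) (sym β⁻¹≡1)) (inv-inverseʳ β≢0)))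
    β⁻¹∉B (at₂ β⁻¹≡β) = β*β∉B (at₁ (trans (cong (β *_) (sym β⁻¹≡β)) (inv-inverseʳ β≢0)))
    β⁻¹∉B (at₃ β⁻¹≡γ) = βγ≢1 (trans (cong (β *_) (sym β⁻¹≡γ)) (inv-inverseʳ β≢0))

    γ*β⁻¹∉B : ¬ InB (γ * β⁻¹)
    γ*β⁻¹∉B = β⁻¹∉B ∘ subst InB γβ⁻¹+1≡β⁻¹ ∘ InB-+1
      where
      open ≡-Reasoning
      γβ⁻¹+1≡β⁻¹ : γ * β⁻¹ + 1# ≡ β⁻¹
      γβ⁻¹+1≡β⁻¹ = begin
        γ * β⁻¹ + 1#         ≡⟨ solve 2 (λ b c → (b :+ con true) :* c :+ con true := b :* c :+ c :+ con true) refl β β⁻¹ ⟩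
        β * β⁻¹ + β⁻¹ + 1#   ≡⟨ cong (λ x → x + β⁻¹ + 1#) (inv-inverseʳ β≢0) ⟩
        1# + β⁻¹ + 1#        ≡⟨ solve 1 (λ c → con true :+ c :+ con true := c) refl β⁻¹ ⟩
        β⁻¹                  ∎

  module Through {p q : Fin n} (p≢q : p ≢ q) where

    d : Fin n
    d = p + q

    d≢0 : d ≢ 0#
    d≢0 = p≢q ∘ x+y≡0⇒x≡y

    d⁻¹ : Fin n
    d⁻¹ = inv d d≢0

    V : Fin n → Fin n
    V w = d⁻¹ * (w + p)

    V[p]≡0 : V p ≡ 0#
    V[p]≡0 = trans (cong (d⁻¹ *_) (x+x≡0 p)) (zeroʳ d⁻¹)

    V[q]≡1 : V q ≡ 1#
    V[q]≡1 = trans (cong (d⁻¹ *_) (+-comm q p)) (inv-inverseˡ d≢0)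

    V[dz+p]≡z : ∀ z → V (d * z + p) ≡ z
    V[dz+p]≡z z = trans (cong (d⁻¹ *_) (x+y+y≡x (d * z) p)) (x*y≡1⇒x*[y*z]≡z (inv-inverseˡ d≢0) z)

    T : Fin n → Subset n
    T e = subsetOf (λ w → InB? (e * V w))

    T-extension : ∀ e → Extension (T e) (λ w → InB (e * V w))
    T-extension e = subsetOf-extension (λ w → InB? (e * V w))

    T-isBlock : ∀ {e} → e ≢ 0# → IsBlock (T e)
    T-isBlock {e} e≢0 = preimage⇒IsBlock (x*y≢0 e≢0 (x*y≡1⇒y≢0 (inv-inverseʳ d≢0)))
      (Extension-cong (λ {w} → subst InB (eV≡ w)) (λ {w} → subst InB (sym (eV≡ w))) (T-extension e))
      where
      eV≡ : ∀ w → e * V w ≡ e * d⁻¹ * w + e * d⁻¹ * p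
      eV≡ w = solve 4 (λ e i w p → e :* (i :* (w :+ p)) := e :* i :* w :+ e :* i :* p) refl e d⁻¹ w p

    p∈T : ∀ e → p ∈ T e
    p∈T e = proj₂ (T-extension e p) (at₀ (trans (cong (e *_) V[p]≡0) (zeroʳ e)))

    q∈T : ∀ {e} → InB e → q ∈ T e
    q∈T {e} e∈B = proj₂ (T-extension e q) (subst InB (sym (trans (cong (e *_) V[q]≡1) (*-identityʳ e))) e∈B)

    T-cong : ∀ {e e′} → (∀ {z} → InB (e * z) → InB (e′ * z)) → (∀ {z} → InB (e′ * z) → InB (e * z)) →
             T e ≡ T e′
    T-cong e⇒e′ e′⇒e = Extension-unique (Extension-cong e⇒e′ e′⇒e (T-extension _)) (T-extension _)

    T≡T⇒ : ∀ {e e′} → T e ≡ T e′ → ∀ z → InB (e * z) → InB (e′ * z)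
    T≡T⇒ {e} {e′} Te≡Te′ z =
        subst (λ x → InB (e′ * x)) (V[dz+p]≡z z) ∘ proj₁ (T-extension e′ w) ∘ subst (w ∈_) Te≡Te′
      ∘ proj₂ (T-extension e w) ∘ subst (λ x → InB (e * x)) (sym (V[dz+p]≡z z))
      where w = d * z + p

    -- For S = {w : c w + s ∈ B} through p and q, e = (c p + s) + (c q + s) = c d and
    -- e * V w = (c w + s) + (c p + s) with c p + s ∈ B; as B is a group, S = T e.
    IsBlock⇒≡T : ∀ {S} → IsBlock S → p ∈ S → q ∈ S → ∃ λ e → InB e × e ≢ 0# × S ≡ T e
    IsBlock⇒≡T S-block p∈S q∈S with IsBlock⇒preimage S-block
    ... | c , c≢0 , s , S≐c⁻¹[B+s] = e , InB-+ x∈B y∈B , e≢0 ,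
      Extension-unique (Extension-cong shift unshift S≐c⁻¹[B+s]) (T-extension e)
      where
      open ≡-Reasoning
      x = c * p + s
      y = c * q + s
      x∈B = proj₁ (S≐c⁻¹[B+s] p) p∈S
      y∈B = proj₁ (S≐c⁻¹[B+s] q) q∈S
      e = x + y
      e≡cd : e ≡ c * d
      e≡cd = solve 4 (λ c p q s → c :* p :+ s :+ (c :* q :+ s) := c :* (p :+ q)) refl c p q s
      e≢0 : e ≢ 0#
      e≢0 = x*y≢0 c≢0 d≢0 ∘ trans (sym e≡cd)
      eV≡cw+s+x : ∀ w → e * V w ≡ c * w + s + x
      eV≡cw+s+x w = begin
        e * V w                   ≡⟨ cong (_* V w) e≡cd ⟩
        c * d * (d⁻¹ * (w + p))   ≡⟨ solve 4 (λ c d i u → c :* d :* (i :* u) := c :* (d :* i) :* u) refl c d d⁻¹ (w + p) ⟩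
        c * (d * d⁻¹) * (w + p)   ≡⟨ cong (λ z → c * z * (w + p)) (inv-inverseʳ d≢0) ⟩
        c * 1# * (w + p)          ≡⟨ solve 4 (λ c w p s → c :* con true :* (w :+ p) := c :* w :+ s :+ (c :* p :+ s)) refl c w p s ⟩
        c * w + s + x             ∎
      shift : ∀ {w} → InB (c * w + s) → InB (e * V w)
      shift {w} cw+s∈B = subst InB (sym (eV≡cw+s+x w)) (InB-+ cw+s∈B x∈B)
      unshift : ∀ {w} → InB (e * V w) → InB (c * w + s)
      unshift {w} eVw∈B = subst InB (x+y+y≡x (c * w + s) x) (InB-+ (subst InB (eV≡cw+s+x w) eVw∈B) x∈B)

    blocks-through : ∀ {S} → IsBlock S → p ∈ S → q ∈ S → S ∈ₗ T 1# ∷ T β ∷ T γ ∷ []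
    blocks-through S-block p∈S q∈S = ≡T⇒∈ (IsBlock⇒≡T S-block p∈S q∈S)
      where
      ≡T⇒∈ : ∀ {S} → (∃ λ e → InB e × e ≢ 0# × S ≡ T e) → S ∈ₗ T 1# ∷ T β ∷ T γ ∷ []
      ≡T⇒∈ (_ , at₀ e≡0  , e≢0 , _   ) = ⊥-elim (e≢0 e≡0)
      ≡T⇒∈ (_ , at₁ refl , _   , S≡Te) = here S≡Te
      ≡T⇒∈ (_ , at₂ refl , _   , S≡Te) = there (here S≡Te)
      ≡T⇒∈ (_ , at₃ refl , _   , S≡Te) = there (there (here S≡Te))

    BlockThrough : Subset n → Set
    BlockThrough S = IsBlock S × p ∈ S × q ∈ S

    T-blockThrough : ∀ {e} → InB e → e ≢ 0# → BlockThrough (T e)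
    T-blockThrough e∈B e≢0 = T-isBlock e≢0 , p∈T _ , q∈T e∈B

    count₁ : β * γ ≡ 1# → ExactlyCount 1 BlockThrough
    count₁ βγ≡1 = T 1# ∷ [] , refl , [] ∷ [] , T-blockThrough (at₁ refl) 1≢0 ∷ [] , complete
      where
      open F4 βγ≡1
      Tβ≡T1 : T β ≡ T 1#
      Tβ≡T1 = T-cong (subst InB (sym (*-identityˡ _)) ∘ β*-stable⁻¹) (β*-stable ∘ subst InB (*-identityˡ _))
      Tγ≡T1 : T γ ≡ T 1#
      Tγ≡T1 = T-cong (subst InB (sym (*-identityˡ _)) ∘ γ*-stable⁻¹) (γ*-stable ∘ subst InB (*-identityˡ _))
      complete : ∀ S → BlockThrough S → S ∈ₗ T 1# ∷ []
      complete S (S-block , p∈S , q∈S) = collapse (blocks-through S-block p∈S q∈S)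
        where
        collapse : ∀ {S} → S ∈ₗ T 1# ∷ T β ∷ T γ ∷ [] → S ∈ₗ T 1# ∷ []
        collapse (here S≡T1)                = here S≡T1
        collapse (there (here S≡Tβ))         = here (trans S≡Tβ Tβ≡T1)
        collapse (there (there (here S≡Tγ))) = here (trans S≡Tγ Tγ≡T1)

    count₃ : β * γ ≢ 1# → ExactlyCount 3 BlockThrough
    count₃ βγ≢1 =
        T 1# ∷ T β ∷ T γ ∷ [] , refl
      , (T1≢Tβ ∷ T1≢Tγ ∷ []) ∷ (Tβ≢Tγ ∷ []) ∷ [] ∷ []
      , T-blockThrough (at₁ refl) 1≢0 ∷ T-blockThrough (at₂ refl) β≢0 ∷ T-blockThrough (at₃ refl) γ≢0 ∷ []
      , λ S (S-block , p∈S , q∈S) → blocks-through S-block p∈S q∈S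
      where
      open NotF4 βγ≢1
      T1≢Tβ : T 1# ≢ T β
      T1≢Tβ T1≡Tβ = β*β∉B (T≡T⇒ T1≡Tβ β (at₂ (*-identityˡ β)))
      T1≢Tγ : T 1# ≢ T γ
      T1≢Tγ T1≡Tγ = γ*γ∉B (T≡T⇒ T1≡Tγ γ (at₃ (*-identityˡ γ)))
      Tβ≢Tγ : T β ≢ T γ
      Tβ≢Tγ Tβ≡Tγ = γ*β⁻¹∉B (T≡T⇒ Tβ≡Tγ β⁻¹ (at₁ (inv-inverseʳ β≢0)))

  design₁ : β * γ ≡ 1# → Is2Design IsBlock 1
  design₁ βγ≡1 = (λ _ → IsBlock⇒∣S∣≡4) , λ _ _ p≢q → Through.count₁ p≢q βγ≡1

  design₃ : β * γ ≢ 1# → Is2Design IsBlock 3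
  design₃ βγ≢1 = (λ _ → IsBlock⇒∣S∣≡4) , λ _ _ p≢q → Through.count₃ p≢q βγ≢1

  module _ {α} (α≢0 : α ≢ 0#) (log : ∀ x → x ≢ 0# → Σ (Fin (n ∸ 1)) λ k → α ^^ toℕ k ≡ x) where

    Translates⇒IsBlock : ∀ {S} → Translates F α β γ S → IsBlock S
    Translates⇒IsBlock (k , t , S≐) = α ^^ toℕ k , ^^-≢0 α≢0 (toℕ k) , t , S≐

    IsBlock⇒Translates : ∀ {S} → IsBlock S → Translates F α β γ S
    IsBlock⇒Translates {S} (a , a≢0 , t , S≐aB+t) =
      k , t , subst (λ x → Extension S (Image x t)) (sym α^k≡a) S≐aB+t
      where
      k = proj₁ (log a a≢0)
      α^k≡a = proj₂ (log a a≢0)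

module BlocksJ-Properties {n : ℕ} (F : FieldOn n) {α : Fin n} (α-primitive : Primitive F α)
    (N-odd : ¬ 2 ∣ n ∸ 1) {j l : ℕ} (0<j : 0 < j) (j<N : j < n ∸ 1) (0<l : 0 < l) (l<N : l < n ∸ 1)
    (α^l≡α^j+1 : FieldOn._^^_ F α l ≡ FieldOn._+_ F (FieldOn._^^_ F α j) (FieldOn.1# F)) where

  open FieldProperties F
  open ≡-Reasoning

  α≢0 : α ≢ 0#
  α≢0 α≡0 = 0≢1 (begin
    0#             ≡⟨ sym (0^^k≡0 0<l) ⟩
    0# ^^ l        ≡⟨ subst (λ x → x ^^ l ≡ x ^^ j + 1#) α≡0 α^l≡α^j+1 ⟩
    0# ^^ j + 1#   ≡⟨ cong (_+ 1#) (0^^k≡0 0<j) ⟩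
    0# + 1#        ≡⟨ +-identityˡ 1# ⟩
    1#             ∎)

  open PrimitiveElement F α-primitive α≢0

  α^j≢1 : α ^^ j ≢ 1#
  α^j≢1 α^j≡1 = ℕₚ.<⇒≢ 0<j (sym (α^a≡α^b⇒a≡b j<N (ℕ.>-nonZero⁻¹ N) α^j≡1))

  1+1≡0 : 1# + 1# ≡ 0#
  1+1≡0 = characteristic-2 N-odd

  open Characteristic2 F 1+1≡0 using (x*[x+1]≡1⇒x*x≡x+1)
  open AffineBlocks F 1+1≡0 (^^-≢0 α≢0 j) α^j≢1

  α^[j+l]≡β*γ : α ^^ (j ℕ.+ l) ≡ α ^^ j * γ
  α^[j+l]≡β*γ = trans (^^-distribˡ-+-* α j l) (cong (α ^^ j *_) α^l≡α^j+1)

  j+l≡N⇒F4 : j ℕ.+ l ≡ N → α ^^ j * γ ≡ 1#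
  j+l≡N⇒F4 j+l≡N = trans (sym α^[j+l]≡β*γ) (trans (cong (α ^^_) j+l≡N) α^N≡1)

  F4⇒j+l≡N : α ^^ j * γ ≡ 1# → j ℕ.+ l ≡ N
  F4⇒j+l≡N βγ≡1 with α^a≡α^b⇒a≡b⊎a≡N+b (ℕₚ.+-mono-< j<N l<N) (ℕ.>-nonZero⁻¹ N) (trans α^[j+l]≡β*γ βγ≡1)
  ... | inj₁ j+l≡0   = ⊥-elim (ℕₚ.<⇒≢ 0<j (sym (ℕₚ.m+n≡0⇒m≡0 j j+l≡0)))
  ... | inj₂ j+l≡N+0 = trans j+l≡N+0 (ℕₚ.+-identityʳ N)

  j+l≡N⇒doubling : j ℕ.+ l ≡ N → j ℕ.+ j ≡ l ⊎ j ℕ.+ j ≡ N ℕ.+ l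
  j+l≡N⇒doubling j+l≡N = α^a≡α^b⇒a≡b⊎a≡N+b (ℕₚ.+-mono-< j<N j<N) l<N (begin
    α ^^ (j ℕ.+ j)     ≡⟨ ^^-distribˡ-+-* α j j ⟩
    α ^^ j * α ^^ j    ≡⟨ x*[x+1]≡1⇒x*x≡x+1 (j+l≡N⇒F4 j+l≡N) ⟩
    α ^^ j + 1#        ≡⟨ sym α^l≡α^j+1 ⟩
    α ^^ l             ∎)

  private
    Design : ℕ → Fin n → Set
    Design λ′ γ′ = Is2Design (Translates F α (α ^^ j) γ′) λ′
                 × (∀ S → Translates F α (α ^^ j) γ′ S → BooleanSQSBlock F S)

    translates-design : ∀ {λ′} → Is2Design IsBlock λ′ → Design λ′ γ
    translates-design IsBlock-design =
        Is2Design-cong (IsBlock⇒Translates α≢0 log) (Translates⇒IsBlock α≢0 log) IsBlock-design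
      , λ _ → IsBlock⇒BooleanSQSBlock ∘ Translates⇒IsBlock α≢0 log

  BlocksJ-design₁ : j ℕ.+ l ≡ N →
    Is2Design (BlocksJ F α j l) 1 × (∀ S → BlocksJ F α j l S → BooleanSQSBlock F S)
  BlocksJ-design₁ j+l≡N = subst (Design 1) (sym α^l≡α^j+1) (translates-design (design₁ (j+l≡N⇒F4 j+l≡N)))

  BlocksJ-design₃ : j ℕ.+ l ≢ N →
    Is2Design (BlocksJ F α j l) 3 × (∀ S → BlocksJ F α j l S → BooleanSQSBlock F S)
  BlocksJ-design₃ j+l≢N = subst (Design 3) (sym α^l≡α^j+1) (translates-design (design₃ (j+l≢N ∘ F4⇒j+l≡N)))

-- From here on _+_ and _*_ are the operations of ℕ.
open import Data.Nat.Base using (_+_; _*_)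

2^[2+m]∸1≡3*2^m+[2^m∸1] : ∀ m → 2 ^ (2 + m) ∸ 1 ≡ 3 * 2 ^ m + (2 ^ m ∸ 1)
2^[2+m]∸1≡3*2^m+[2^m∸1] m =
  trans (cong (_∸ 1) 4*2^m≡3*2^m+2^m) (ℕₚ.+-∸-assoc (3 * 2 ^ m) (ℕₚ.m^n>0 2 m))
  where
  4*2^m≡3*2^m+2^m : 2 * (2 * 2 ^ m) ≡ 3 * 2 ^ m + 2 ^ m
  4*2^m≡3*2^m+2^m = trans (sym (ℕₚ.*-assoc 2 2 (2 ^ m))) (ℕₚ.+-comm (2 ^ m) (3 * 2 ^ m))

2∣m⇒3∣2^m∸1 : ∀ m → 2 ∣ m → 3 ∣ 2 ^ m ∸ 1
2∣m⇒3∣2^m∸1 zero          _     = 3 ∣0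
2∣m⇒3∣2^m∸1 (suc zero)    2∣1   = ⊥-elim (>⇒∤ (ℕₚ.n<1+n 1) 2∣1)
2∣m⇒3∣2^m∸1 (suc (suc m)) 2∣2+m = subst (3 ∣_) (sym (2^[2+m]∸1≡3*2^m+[2^m∸1] m))
  (∣m∣n⇒∣m+n (m∣m*n (2 ^ m)) (2∣m⇒3∣2^m∸1 m (∣m+n∣m⇒∣n 2∣2+m ∣-refl)))

3∣2^m∸1⇒2∣m : ∀ m → 3 ∣ 2 ^ m ∸ 1 → 2 ∣ m
3∣2^m∸1⇒2∣m zero          _       = 2 ∣0
3∣2^m∸1⇒2∣m (suc zero)    3∣1     = ⊥-elim (>⇒∤ (s≤s (s≤s z≤n)) 3∣1)
3∣2^m∸1⇒2∣m (suc (suc m)) 3∣2^m∸1 = ∣m∣n⇒∣m+n ∣-refl (3∣2^m∸1⇒2∣m m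
  (∣m+n∣m⇒∣n (subst (3 ∣_) (2^[2+m]∸1≡3*2^m+[2^m∸1] m) 3∣2^m∸1) (m∣m*n (2 ^ m))))

¬2∣2^m∸1 : ∀ {m} → 0 < m → ¬ 2 ∣ 2 ^ m ∸ 1
¬2∣2^m∸1 {suc m} _ 2∣2^m∸1 = >⇒∤ (ℕₚ.n<1+n 1) (∣m+n∣m⇒∣n 2∣[2^m∸1]+1 2∣2^m∸1)
  where
  2∣[2^m∸1]+1 : 2 ∣ 2 ^ suc m ∸ 1 + 1
  2∣[2^m∸1]+1 = subst (2 ∣_) (sym (ℕₚ.m∸n+n≡m (ℕₚ.m^n>0 2 (suc m)))) (m∣m*n (2 ^ m))

≤2^m∸2⇒<2^m∸1 : ∀ {m j} → 1 ≤ m → j ≤ 2 ^ m ∸ 2 → j < 2 ^ m ∸ 1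
≤2^m∸2⇒<2^m∸1 1≤m j≤2^m∸2 = ℕₚ.≤-<-trans j≤2^m∸2 (ℕₚ.∸-monoʳ-< (ℕₚ.n<1+n 1) (ℕₚ.^-monoʳ-≤ 2 1≤m))

IsThirds : ℕ → ℕ → ℕ → Set
IsThirds N j l = (j ≡ N / 3 × l ≡ (2 * N) / 3) ⊎ (l ≡ N / 3 × j ≡ (2 * N) / 3)

N≡q*3⇒thirds : ∀ {N} q → N ≡ q * 3 → N / 3 ≡ q × (2 * N) / 3 ≡ 2 * q
N≡q*3⇒thirds q refl =
  m*n/n≡m q 3 , trans (cong (_/ 3) (sym (ℕₚ.*-assoc 2 q 3))) (m*n/n≡m (2 * q) 3)

third+twoThirds≡N : ∀ {N j l} → 3 ∣ N → j ≡ N / 3 → l ≡ (2 * N) / 3 → j + l ≡ N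
third+twoThirds≡N {N} {j} {l} (divides q N≡q*3) j≡N/3 l≡2N/3 = begin
  j + l       ≡⟨ cong₂ _+_ (trans j≡N/3 (proj₁ thirds)) (trans l≡2N/3 (proj₂ thirds)) ⟩
  q + 2 * q   ≡⟨ ℕₚ.*-comm 3 q ⟩
  q * 3       ≡⟨ sym N≡q*3 ⟩
  N           ∎
  where
  open ≡-Reasoning
  thirds = N≡q*3⇒thirds q N≡q*3

thirds⇒sum : ∀ {N j l} → 3 ∣ N → IsThirds N j l → j + l ≡ N
thirds⇒sum 3∣N (inj₁ (j≡N/3 , l≡2N/3)) = third+twoThirds≡N 3∣N j≡N/3 l≡2N/3
thirds⇒sum {j = j} {l} 3∣N (inj₂ (l≡N/3 , j≡2N/3)) =
  trans (ℕₚ.+-comm j l) (third+twoThirds≡N 3∣N l≡N/3 j≡2N/3)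

doubling⇒thirds : ∀ {N j l} → j + l ≡ N → j + j ≡ l → 3 ∣ N × j ≡ N / 3 × l ≡ (2 * N) / 3
doubling⇒thirds {N} {j} {l} j+l≡N j+j≡l =
  divides j N≡j*3 , sym (proj₁ thirds) , trans (sym j+j≡l) (trans j+j≡2*j (sym (proj₂ thirds)))
  where
  j+j≡2*j : j + j ≡ 2 * j
  j+j≡2*j = cong (j +_) (sym (ℕₚ.+-identityʳ j))
  N≡j*3 : N ≡ j * 3
  N≡j*3 = trans (sym j+l≡N) (trans (cong (j +_) (trans (sym j+j≡l) j+j≡2*j)) (ℕₚ.*-comm 3 j))
  thirds = N≡q*3⇒thirds j N≡j*3

sum∧doubling⇒thirds : ∀ {N j l} → j + l ≡ N → j + j ≡ l ⊎ j + j ≡ N + l → 3 ∣ N × IsThirds N j l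
sum∧doubling⇒thirds j+l≡N (inj₁ j+j≡l) = map₂ inj₁ (doubling⇒thirds j+l≡N j+j≡l)
sum∧doubling⇒thirds {N} {j} {l} j+l≡N (inj₂ j+j≡N+l) =
  map₂ inj₂ (doubling⇒thirds (trans (ℕₚ.+-comm l j) j+l≡N) l+l≡j)
  where
  open ≡-Reasoning
  l+l≡j : l + l ≡ j
  l+l≡j = ℕₚ.+-cancelˡ-≡ j (l + l) j (begin
    j + (l + l)   ≡⟨ sym (ℕₚ.+-assoc j l l) ⟩
    j + l + l     ≡⟨ cong (_+ l) j+l≡N ⟩
    N + l         ≡⟨ sym j+j≡N+l ⟩
    j + j         ∎)

lemma4p3 : (m : ℕ) → 2 ≤ m →
    (F : FieldOn (2 ^ m)) → (α : Fin (2 ^ m)) → Primitive F α →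
    (j l : ℕ) → 1 ≤ j → j ≤ 2 ^ m ∸ 2 → 1 ≤ l → l ≤ 2 ^ m ∸ 2 →
    FieldOn._^^_ F α l ≡ FieldOn._+_ F (FieldOn._^^_ F α j) (FieldOn.1# F) →
    ((2 ∣ m × ((j ≡ (2 ^ m ∸ 1) / 3 × l ≡ (2 * (2 ^ m ∸ 1)) / 3)
             ⊎ (l ≡ (2 ^ m ∸ 1) / 3 × j ≡ (2 * (2 ^ m ∸ 1)) / 3))) →
       Is2Design (BlocksJ F α j l) 1
       × (∀ (S : Subset (2 ^ m)) → BlocksJ F α j l S → BooleanSQSBlock F S))
    × (¬ (2 ∣ m × ((j ≡ (2 ^ m ∸ 1) / 3 × l ≡ (2 * (2 ^ m ∸ 1)) / 3)
                 ⊎ (l ≡ (2 ^ m ∸ 1) / 3 × j ≡ (2 * (2 ^ m ∸ 1)) / 3))) →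
       Is2Design (BlocksJ F α j l) 3
       × (∀ (S : Subset (2 ^ m)) → BlocksJ F α j l S → BooleanSQSBlock F S))
lemma4p3 m 2≤m F α α-primitive j l 1≤j j≤2^m∸2 1≤l l≤2^m∸2 α^l≡α^j+1 =
    (λ (2∣m , thirds) → BlocksJ-design₁ (thirds⇒sum (2∣m⇒3∣2^m∸1 m 2∣m) thirds))
  , (λ ¬[2∣m×thirds] → BlocksJ-design₃ (¬[2∣m×thirds] ∘ 2∣m×thirds))
  where
  1≤m = ℕₚ.<⇒≤ 2≤m
  open BlocksJ-Properties F α-primitive (¬2∣2^m∸1 1≤m)
         1≤j (≤2^m∸2⇒<2^m∸1 1≤m j≤2^m∸2) 1≤l (≤2^m∸2⇒<2^m∸1 1≤m l≤2^m∸2) α^l≡α^j+1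
  2∣m×thirds : j + l ≡ 2 ^ m ∸ 1 → 2 ∣ m × IsThirds (2 ^ m ∸ 1) j l
  2∣m×thirds j+l≡N = map₁ (3∣2^m∸1⇒2∣m m) (sum∧doubling⇒thirds j+l≡N (j+l≡N⇒doubling j+l≡N))
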